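{- Let $r\ge2$, $\ell\ge1$, $n\ge1$, and $\mathbf x=(x_{m,i,j})_{m\in[\ell],i<j\in[r]}\in\mathbb N^{\ell\times\binom r2}$ with $|\mathbf x_{i,j}|\le n$ for all $i\ne j\in[r]$. Then \[\frac{\prod_{i<j}(n)_{(|\mathbf x_{i,j}|)}}{\prod_{i=1}^r((r-1)n)_{(|\mathbf x_i|)}}\le\frac{2^{2|\mathbf x|}}{n^{|\mathbf x|}}.\]
   Context: Convention $x_{m,i,j}=x_{m,j,i}$ for $i>j$. $|\mathbf x|=\sum_{m,i<j}x_{m,i,j}$, $|\mathbf x_{i,j}|=\sum_m x_{m,i,j}$, $|\mathbf x_i|=\sum_m\sum_{j\ne i}x_{m,i,j}$. $a_{(b)}=a(a-1)\cdots(a-b+1)$. -}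

module Defs where

open import Data.Nat using (ℕ; zero; suc; _+_; _*_; _∸_; _<_; _<?_)
open import Data.Fin using (Fin; toℕ)
open import Data.List using (List; map; foldr; filter; allFin; concatMap; _∷_; [])
open import Data.Product using (_×_; _,_)
open import Relation.Nullary using (does; ¬_)
open import Relation.Nullary.Decidable using (¬?)
open import Data.Fin using (_≟_)
open import Data.Bool using (if_then_else_)

_⁽_⁾ : ℕ → ℕ → ℕ
a ⁽ zero ⁾ = 1
a ⁽ suc b ⁾ = (a ⁽ b ⁾) * (a ∸ b)

Σ[_]_ : ∀ {A : Set} → List A → (A → ℕ) → ℕ
Σ[ xs ] f = foldr (λ a s → f a + s) 0 xs

Π[_]_ : ∀ {A : Set} → List A → (A → ℕ) → ℕ
Π[ xs ] f = foldr (λ a s → f a * s) 1 xs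

pairs< : (r : ℕ) → List (Fin r × Fin r)
pairs< r = concatMap (λ i → map (λ j → (i , j)) (filter (λ j → toℕ i <? toℕ j) (allFin r))) (allFin r)

-- the array x = (x_{m,i,j}) : only entries with i < j are meaningful;
-- convention x_{m,i,j} = x_{m,j,i} for i > j
Array : ℕ → ℕ → Set
Array ℓ r = Fin ℓ → Fin r → Fin r → ℕ

entry : ∀ {ℓ r} → Array ℓ r → Fin ℓ → Fin r → Fin r → ℕ
entry x m i j = if does (toℕ i <? toℕ j) then x m i j else x m j i

∣_∣ᵢⱼ : ∀ {ℓ r} → Array ℓ r → Fin r → Fin r → ℕ
∣_∣ᵢⱼ {ℓ} x i j = Σ[ allFin ℓ ] (λ m → entry x m i j)

∣_∣ᵢ : ∀ {ℓ r} → Array ℓ r → Fin r → ℕ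
∣_∣ᵢ {ℓ} {r} x i = Σ[ filter (λ j → ¬? (i ≟ j)) (allFin r) ] (λ j → ∣ x ∣ᵢⱼ i j)

∣_∣ : ∀ {ℓ r} → Array ℓ r → ℕ
∣_∣ {ℓ} {r} x = Σ[ pairs< r ] (λ { (i , j) → ∣ x ∣ᵢⱼ i j })

{-# OPTIONS --safe #-}
-- For a single pair, a ≤ n gives n ^ a ≤ 4 ^ a · n₍ₐ₎, because (1 + 1/m) ^ k ≤ 4 for k ≤ m.
-- This trades n ^ |x| for 4 ^ |x| times a second copy of Π_{i<j} n₍|x_ij|₎, and the square of
-- that product, by symmetry of |x_ij|, is Π_i Π_{j ≠ i} n₍|x_ij|₎. Finally, for each i, a product
-- of r - 1 falling factorials n₍a_j₎ with a_j ≤ n is at most the single falling factorial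
-- ((r - 1) n)₍Σ_j a_j₎, since N₍s + a₎ = N₍s₎ (N - s)₍a₎.
module Submission where

open import Defs
open import Data.Nat using (ℕ; zero; suc; _+_; _*_; _∸_; _^_; _≤_; _<_; _<?_; _≤?_; z≤n; s≤s; ⌊_/2⌋; ⌈_/2⌉)
open import Data.Nat.Properties hiding (_≟_)
open import Data.Fin using (Fin; toℕ; _≟_)
open import Data.Fin.Properties using (toℕ-injective)
open import Data.List using (List; []; _∷_; _++_; filter; concatMap; length; allFin)
open import Data.List.Properties using (foldr-cong; foldr-map; filter-notAll; length-tabulate)
import Data.List.Relation.Unary.All as All
open All using (All; []; _∷_)
open import Data.List.Relation.Unary.All.Properties using (all-filter; concat⁺; map⁺; tabulate⁺)
import Data.List.Relation.Unary.Any as Any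
open import Data.List.Membership.Propositional.Properties using (∈-allFin)
open import Data.Product using (_×_; _,_; uncurry)
open import Data.Bool using (true; false; if_then_else_)
open import Relation.Nullary using (Dec; yes; no; does; contradiction)
open import Relation.Nullary.Decidable using (¬?)
open import Relation.Unary using (Pred; Decidable)
open import Relation.Binary.PropositionalEquality
open import Relation.Binary.Definitions using (tri<; tri≈; tri>)
open import Algebra.Properties.CommutativeSemigroup *-commutativeSemigroup
  using (interchange; x∙yz≈y∙xz; x∙yz≈xz∙y; xy∙z≈y∙xz)

⁽⁾-+ : ∀ N s a → N ⁽ s + a ⁾ ≡ N ⁽ s ⁾ * (N ∸ s) ⁽ a ⁾
⁽⁾-+ N s zero = trans (cong (N ⁽_⁾) (+-identityʳ s)) (sym (*-identityʳ _))
⁽⁾-+ N s (suc a) = begin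
    N ⁽ s + suc a ⁾                             ≡⟨ cong (N ⁽_⁾) (+-suc s a) ⟩
    N ⁽ s + a ⁾ * (N ∸ (s + a))                 ≡⟨ cong₂ _*_ (⁽⁾-+ N s a) (sym (∸-+-assoc N s a)) ⟩
    N ⁽ s ⁾ * (N ∸ s) ⁽ a ⁾ * (N ∸ s ∸ a)       ≡⟨ *-assoc (N ⁽ s ⁾) _ _ ⟩
    N ⁽ s ⁾ * ((N ∸ s) ⁽ a ⁾ * (N ∸ s ∸ a))     ∎
  where open ≡-Reasoning

⁽⁾-monoˡ-≤ : ∀ {m n} a → m ≤ n → m ⁽ a ⁾ ≤ n ⁽ a ⁾
⁽⁾-monoˡ-≤ zero    m≤n = ≤-refl
⁽⁾-monoˡ-≤ (suc a) m≤n = *-mono-≤ (⁽⁾-monoˡ-≤ a m≤n) (∸-monoˡ-≤ a m≤n)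

[1+m]⁽1+a⁾≡[1+m]*m⁽a⁾ : ∀ m a → suc m ⁽ suc a ⁾ ≡ suc m * m ⁽ a ⁾
[1+m]⁽1+a⁾≡[1+m]*m⁽a⁾ m a = trans (⁽⁾-+ (suc m) 1 a) (cong (_* m ⁽ a ⁾) (*-identityˡ (suc m)))

m⁽b⁾*n⁽a⁾≤[m+n]⁽b+a⁾ : ∀ {m n} b a → b ≤ m → m ⁽ b ⁾ * n ⁽ a ⁾ ≤ (m + n) ⁽ b + a ⁾
m⁽b⁾*n⁽a⁾≤[m+n]⁽b+a⁾ {m} {n} b a b≤m = begin
    m ⁽ b ⁾ * n ⁽ a ⁾                 ≤⟨ *-mono-≤ (⁽⁾-monoˡ-≤ b (m≤m+n m n)) (⁽⁾-monoˡ-≤ a n≤m+n∸b) ⟩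
    (m + n) ⁽ b ⁾ * (m + n ∸ b) ⁽ a ⁾ ≡⟨ ⁽⁾-+ (m + n) b a ⟨
    (m + n) ⁽ b + a ⁾                 ∎
  where
  open ≤-Reasoning
  n≤m+n∸b : n ≤ m + n ∸ b
  n≤m+n∸b = ≤-trans (m≤n+m n (m ∸ b)) (≤-reflexive (sym (+-∸-comm n b≤m)))

[1+m]*[m∸k]≤m*[1+m∸k] : ∀ m k → suc m * (m ∸ k) ≤ m * (suc m ∸ k)
[1+m]*[m∸k]≤m*[1+m∸k] m k with k ≤? m
... | yes k≤m rewrite +-∸-assoc 1 k≤m = begin
    (m ∸ k) + m * (m ∸ k) ≤⟨ +-monoˡ-≤ (m * (m ∸ k)) (m∸n≤m m k) ⟩
    m + m * (m ∸ k)       ≡⟨ *-suc m (m ∸ k) ⟨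
    m * suc (m ∸ k)       ∎
  where open ≤-Reasoning
... | no k≰m rewrite m≤n⇒m∸n≡0 (<⇒≤ (≰⇒> k≰m)) | *-zeroʳ m = z≤n

-- Bernoulli's inequality (1 - 1/(m+1)) ^ k ≥ 1 - k/(m+1), cleared of denominators.
[1+m]^k*[1+m∸k]≤[1+m]*m^k : ∀ m k → suc m ^ k * (suc m ∸ k) ≤ suc m * m ^ k
[1+m]^k*[1+m∸k]≤[1+m]*m^k m zero = ≤-reflexive (trans (+-identityʳ _) (sym (*-identityʳ _)))
[1+m]^k*[1+m∸k]≤[1+m]*m^k m (suc k) = begin
    suc m * suc m ^ k * (m ∸ k)     ≡⟨ xy∙z≈y∙xz (suc m) (suc m ^ k) (m ∸ k) ⟩
    suc m ^ k * (suc m * (m ∸ k))   ≤⟨ *-monoʳ-≤ (suc m ^ k) ([1+m]*[m∸k]≤m*[1+m∸k] m k) ⟩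
    suc m ^ k * (m * (suc m ∸ k))   ≡⟨ x∙yz≈y∙xz (suc m ^ k) m (suc m ∸ k) ⟩
    m * (suc m ^ k * (suc m ∸ k))   ≤⟨ *-monoʳ-≤ m ([1+m]^k*[1+m∸k]≤[1+m]*m^k m k) ⟩
    m * (suc m * m ^ k)             ≡⟨ x∙yz≈y∙xz m (suc m) (m ^ k) ⟩
    suc m * (m * m ^ k)             ∎
  where open ≤-Reasoning

k+k≤1+m⇒[1+m]^k≤2*m^k : ∀ m k → k + k ≤ suc m → suc m ^ k ≤ 2 * m ^ k
k+k≤1+m⇒[1+m]^k≤2*m^k m k k+k≤1+m = *-cancelʳ-≤ (suc m ^ k) (2 * m ^ k) (suc m) (begin
    suc m ^ k * suc m               ≤⟨ *-monoʳ-≤ (suc m ^ k) 1+m≤2*[1+m∸k] ⟩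
    suc m ^ k * (2 * (suc m ∸ k))   ≡⟨ x∙yz≈y∙xz (suc m ^ k) 2 (suc m ∸ k) ⟩
    2 * (suc m ^ k * (suc m ∸ k))   ≤⟨ *-monoʳ-≤ 2 ([1+m]^k*[1+m∸k]≤[1+m]*m^k m k) ⟩
    2 * (suc m * m ^ k)             ≡⟨ x∙yz≈xz∙y 2 (suc m) (m ^ k) ⟩
    2 * m ^ k * suc m               ∎)
  where
  open ≤-Reasoning
  1+m≤2*[1+m∸k] : suc m ≤ 2 * (suc m ∸ k)
  1+m≤2*[1+m∸k] = begin
    suc m                       ≡⟨ m+[n∸m]≡n (m+n≤o⇒n≤o k k+k≤1+m) ⟨
    k + (suc m ∸ k)             ≤⟨ +-monoˡ-≤ (suc m ∸ k) (m+n≤o⇒m≤o∸n k k+k≤1+m) ⟩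
    (suc m ∸ k) + (suc m ∸ k)   ≡⟨ cong ((suc m ∸ k) +_) (+-identityʳ (suc m ∸ k)) ⟨
    2 * (suc m ∸ k)             ∎

k≤m⇒[1+m]^k≤4*m^k : ∀ m k → k ≤ m → suc m ^ k ≤ 4 * m ^ k
k≤m⇒[1+m]^k≤4*m^k m k k≤m = begin
    suc m ^ k                 ≡⟨ cong (suc m ^_) a+b≡k ⟨
    suc m ^ (a + b)           ≡⟨ ^-distribˡ-+-* (suc m) a b ⟩
    suc m ^ a * suc m ^ b     ≤⟨ *-mono-≤ (k+k≤1+m⇒[1+m]^k≤2*m^k m a a+a≤1+m) (k+k≤1+m⇒[1+m]^k≤2*m^k m b b+b≤1+m) ⟩
    2 * m ^ a * (2 * m ^ b)   ≡⟨ interchange 2 (m ^ a) 2 (m ^ b) ⟩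
    4 * (m ^ a * m ^ b)       ≡⟨ cong (4 *_) (^-distribˡ-+-* m a b) ⟨
    4 * m ^ (a + b)           ≡⟨ cong (λ e → 4 * m ^ e) a+b≡k ⟩
    4 * m ^ k                 ∎
  where
  open ≤-Reasoning
  a = ⌊ k /2⌋
  b = ⌈ k /2⌉
  a+b≡k : a + b ≡ k
  a+b≡k = ⌊n/2⌋+⌈n/2⌉≡n k
  a+a≤1+m : a + a ≤ suc m
  a+a≤1+m = begin
    a + a   ≤⟨ +-monoʳ-≤ a (⌊n/2⌋≤⌈n/2⌉ k) ⟩
    a + b   ≡⟨ a+b≡k ⟩
    k       ≤⟨ m≤n⇒m≤1+n k≤m ⟩
    suc m   ∎
  b+b≤1+m : b + b ≤ suc m
  b+b≤1+m = begin
    b + b         ≤⟨ +-monoʳ-≤ b (⌊n/2⌋-mono (n≤1+n (suc k))) ⟩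
    b + suc a     ≡⟨ +-suc b a ⟩
    suc (b + a)   ≡⟨ cong suc (trans (+-comm b a) a+b≡k) ⟩
    suc k         ≤⟨ s≤s k≤m ⟩
    suc m         ∎

a≤n⇒n^a≤4^a*n⁽a⁾ : ∀ {n} a → a ≤ n → n ^ a ≤ 4 ^ a * n ⁽ a ⁾
a≤n⇒n^a≤4^a*n⁽a⁾ zero _ = ≤-refl
a≤n⇒n^a≤4^a*n⁽a⁾ {suc m} (suc a) (s≤s a≤m) = begin
    suc m * suc m ^ a                 ≤⟨ *-monoʳ-≤ (suc m) (k≤m⇒[1+m]^k≤4*m^k m a a≤m) ⟩
    suc m * (4 * m ^ a)               ≤⟨ *-monoʳ-≤ (suc m) (*-monoʳ-≤ 4 (a≤n⇒n^a≤4^a*n⁽a⁾ a a≤m)) ⟩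
    suc m * (4 * (4 ^ a * m ⁽ a ⁾))   ≡⟨ cong (suc m *_) (*-assoc 4 (4 ^ a) (m ⁽ a ⁾)) ⟨
    suc m * (4 ^ suc a * m ⁽ a ⁾)     ≡⟨ x∙yz≈y∙xz (suc m) (4 ^ suc a) (m ⁽ a ⁾) ⟩
    4 ^ suc a * (suc m * m ⁽ a ⁾)     ≡⟨ cong (4 ^ suc a *_) ([1+m]⁽1+a⁾≡[1+m]*m⁽a⁾ m a) ⟨
    4 ^ suc a * suc m ⁽ suc a ⁾       ∎
  where open ≤-Reasoning

private variable
  A B : Set

Π-cong : ∀ (xs : List A) {f g : A → ℕ} → (∀ a → f a ≡ g a) → Π[ xs ] f ≡ Π[ xs ] g
Π-cong xs f≗g = foldr-cong (λ a s → cong (_* s) (f≗g a)) refl xs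

Π-mono-≤ : ∀ (xs : List A) {f g : A → ℕ} → (∀ a → f a ≤ g a) → Π[ xs ] f ≤ Π[ xs ] g
Π-mono-≤ []       f≤g = ≤-refl
Π-mono-≤ (x ∷ xs) f≤g = *-mono-≤ (f≤g x) (Π-mono-≤ xs f≤g)

Π-distrib-* : ∀ (xs : List A) (f g : A → ℕ) → Π[ xs ] (λ a → f a * g a) ≡ Π[ xs ] f * Π[ xs ] g
Π-distrib-* []       f g = refl
Π-distrib-* (x ∷ xs) f g =
  trans (cong (f x * g x *_) (Π-distrib-* xs f g)) (interchange (f x) (g x) _ _)

Π-const-1 : ∀ (xs : List A) → Π[ xs ] (λ _ → 1) ≡ 1
Π-const-1 []       = refl
Π-const-1 (x ∷ xs) = trans (+-identityʳ _) (Π-const-1 xs)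

Π-comm : ∀ (xs : List A) (ys : List B) (g : A → B → ℕ) →
         Π[ xs ] (λ a → Π[ ys ] (g a)) ≡ Π[ ys ] (λ b → Π[ xs ] (λ a → g a b))
Π-comm []       ys g = sym (Π-const-1 ys)
Π-comm (x ∷ xs) ys g = trans (cong (Π[ ys ] (g x) *_) (Π-comm xs ys g))
                             (sym (Π-distrib-* ys (g x) (λ b → Π[ xs ] (λ a → g a b))))

Π-++ : ∀ (xs ys : List A) (f : A → ℕ) → Π[ xs ++ ys ] f ≡ Π[ xs ] f * Π[ ys ] f
Π-++ []       ys f = sym (+-identityʳ _)
Π-++ (x ∷ xs) ys f = trans (cong (f x *_) (Π-++ xs ys f)) (sym (*-assoc (f x) _ _))

Π-concatMap : ∀ (h : A → List B) (xs : List A) (f : B → ℕ) →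
              Π[ concatMap h xs ] f ≡ Π[ xs ] (λ a → Π[ h a ] f)
Π-concatMap h []       f = refl
Π-concatMap h (x ∷ xs) f = trans (Π-++ (h x) (concatMap h xs) f) (cong (Π[ h x ] f *_) (Π-concatMap h xs f))

when : ∀ {p} {P : Set p} → Dec P → ℕ → ℕ
when P? v = if does P? then v else 1

Π-filter : ∀ {p} {P : Pred A p} (P? : Decidable P) (xs : List A) (f : A → ℕ) →
           Π[ filter P? xs ] f ≡ Π[ xs ] (λ a → when (P? a) (f a))
Π-filter P? []       f = refl
Π-filter P? (x ∷ xs) f with does (P? x)
... | true  = cong (f x *_) (Π-filter P? xs f)
... | false = trans (Π-filter P? xs f) (sym (+-identityʳ _))

n^Σ≤4^Σ*Πn⁽⁾ : ∀ {n} (xs : List A) {f : A → ℕ} → All (λ a → f a ≤ n) xs →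
               n ^ Σ[ xs ] f ≤ 4 ^ Σ[ xs ] f * Π[ xs ] (λ a → n ⁽ f a ⁾)
n^Σ≤4^Σ*Πn⁽⁾           []       []       = ≤-refl
n^Σ≤4^Σ*Πn⁽⁾ {n = n} (y ∷ ys) {f} (fy≤n ∷ fys≤n) = begin
    n ^ (f y + s)                                ≡⟨ ^-distribˡ-+-* n (f y) s ⟩
    n ^ f y * n ^ s                              ≤⟨ *-mono-≤ (a≤n⇒n^a≤4^a*n⁽a⁾ (f y) fy≤n) (n^Σ≤4^Σ*Πn⁽⁾ ys fys≤n) ⟩
    4 ^ f y * n ⁽ f y ⁾ * (4 ^ s * Π)           ≡⟨ interchange (4 ^ f y) (n ⁽ f y ⁾) (4 ^ s) Π ⟩
    4 ^ f y * 4 ^ s * (n ⁽ f y ⁾ * Π)           ≡⟨ cong (_* (n ⁽ f y ⁾ * Π)) (^-distribˡ-+-* 4 (f y) s) ⟨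
    4 ^ (f y + s) * (n ⁽ f y ⁾ * Π)             ∎
  where
  open ≤-Reasoning
  s = Σ[ ys ] f
  Π = Π[ ys ] (λ a → n ⁽ f a ⁾)

Πn⁽⁾≤[length*n]⁽Σ⁾ : ∀ {n} (xs : List A) {f : A → ℕ} → All (λ a → f a ≤ n) xs →
                     Π[ xs ] (λ a → n ⁽ f a ⁾) ≤ (length xs * n) ⁽ Σ[ xs ] f ⁾
Πn⁽⁾≤[length*n]⁽Σ⁾         []       []               = ≤-refl
Πn⁽⁾≤[length*n]⁽Σ⁾ {n = n} (y ∷ ys) {f} (fy≤n ∷ fys≤n) =
  ≤-trans (*-monoʳ-≤ (n ⁽ f y ⁾) (Πn⁽⁾≤[length*n]⁽Σ⁾ ys fys≤n)) (m⁽b⁾*n⁽a⁾≤[m+n]⁽b+a⁾ (f y) (Σ[ ys ] f) fy≤n)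

module _ {r : ℕ} where

  above below others : Fin r → List (Fin r)
  above  i = filter (λ j → toℕ i <? toℕ j) (allFin r)
  below  i = filter (λ j → toℕ j <? toℕ i) (allFin r)
  others i = filter (λ j → ¬? (i ≟ j)) (allFin r)

  Π-pairs< : (g : Fin r × Fin r → ℕ) →
             Π[ pairs< r ] g ≡ Π[ allFin r ] (λ i → Π[ above i ] (λ j → g (i , j)))
  Π-pairs< g = trans (Π-concatMap _ (allFin r) g)
                     (Π-cong (allFin r) (λ i → foldr-map _ (i ,_) 1 (above i)))

  pairs<-increasing : All (uncurry λ i j → toℕ i < toℕ j) (pairs< r)
  pairs<-increasing = concat⁺ (map⁺ (tabulate⁺ λ i → map⁺ (all-filter (λ j → toℕ i <? toℕ j) (allFin r))))

  length-others : ∀ i → length (others i) ≤ r ∸ 1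
  length-others i = <⇒≤pred (subst (length (others i) <_) (length-tabulate {n = r} (λ j → j))
    (filter-notAll (λ j → ¬? (i ≟ j)) (allFin r) (Any.map (λ i≡j i≢j → i≢j i≡j) (∈-allFin i))))

  if-≢-split : ∀ (i j : Fin r) v →
    when (¬? (i ≟ j)) v ≡ when (toℕ i <? toℕ j) v * when (toℕ j <? toℕ i) v
  if-≢-split i j v = split (i ≟ j) (toℕ i <? toℕ j) (toℕ j <? toℕ i)
    where
    split : (i≟j : Dec (i ≡ j)) (i<?j : Dec (toℕ i < toℕ j)) (j<?i : Dec (toℕ j < toℕ i)) →
            when (¬? i≟j) v ≡ when i<?j v * when j<?i v
    split (yes i≡j) (yes i<j) _         = contradiction i<j (<-irrefl (cong toℕ i≡j))
    split (yes i≡j) (no _)    (yes j<i) = contradiction j<i (<-irrefl (cong toℕ (sym i≡j)))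
    split (yes _)   (no _)    (no _)    = refl
    split (no _)    (yes i<j) (yes j<i) = contradiction j<i (<-asym i<j)
    split (no _)    (yes _)   (no _)    = sym (*-identityʳ v)
    split (no _)    (no _)    (yes _)   = sym (+-identityʳ v)
    split (no i≢j)  (no i≮j)  (no j≮i)  = contradiction (toℕ-injective (≤-antisym (≮⇒≥ j≮i) (≮⇒≥ i≮j))) i≢j

  Π-others : ∀ i (f : Fin r → ℕ) → Π[ others i ] f ≡ Π[ above i ] f * Π[ below i ] f
  Π-others i f = begin
    Π[ others i ] f
      ≡⟨ Π-filter (λ j → ¬? (i ≟ j)) (allFin r) f ⟩
    Π[ allFin r ] (λ j → when (¬? (i ≟ j)) (f j))
      ≡⟨ Π-cong (allFin r) (λ j → if-≢-split i j (f j)) ⟩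
    Π[ allFin r ] (λ j → when (toℕ i <? toℕ j) (f j) * when (toℕ j <? toℕ i) (f j))
      ≡⟨ Π-distrib-* (allFin r) (λ j → when (toℕ i <? toℕ j) (f j)) (λ j → when (toℕ j <? toℕ i) (f j)) ⟩
    Π[ allFin r ] (λ j → when (toℕ i <? toℕ j) (f j)) * Π[ allFin r ] (λ j → when (toℕ j <? toℕ i) (f j))
      ≡⟨ cong₂ _*_ (Π-filter (λ j → toℕ i <? toℕ j) (allFin r) f) (Π-filter (λ j → toℕ j <? toℕ i) (allFin r) f) ⟨
    Π[ above i ] f * Π[ below i ] f
      ∎
    where open ≡-Reasoning

  module _ (g : Fin r → Fin r → ℕ) (g-sym : ∀ i j → g i j ≡ g j i) where

    Π-above≡Π-below : Π[ allFin r ] (λ i → Π[ above i ] (g i)) ≡ Π[ allFin r ] (λ i → Π[ below i ] (g i))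
    Π-above≡Π-below = begin
      Π[ allFin r ] (λ i → Π[ above i ] (g i))
        ≡⟨ Π-cong (allFin r) (λ i → Π-filter (λ j → toℕ i <? toℕ j) (allFin r) (g i)) ⟩
      Π[ allFin r ] (λ i → Π[ allFin r ] (λ j → when (toℕ i <? toℕ j) (g i j)))
        ≡⟨ Π-comm (allFin r) (allFin r) (λ i j → when (toℕ i <? toℕ j) (g i j)) ⟩
      Π[ allFin r ] (λ j → Π[ allFin r ] (λ i → when (toℕ i <? toℕ j) (g i j)))
        ≡⟨ Π-cong (allFin r) (λ j → Π-filter (λ i → toℕ i <? toℕ j) (allFin r) (λ i → g i j)) ⟨
      Π[ allFin r ] (λ j → Π[ below j ] (λ i → g i j))
        ≡⟨ Π-cong (allFin r) (λ j → Π-cong (below j) (λ i → g-sym i j)) ⟩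
      Π[ allFin r ] (λ j → Π[ below j ] (g j))
        ∎
      where open ≡-Reasoning

    Π-pairs<-squared : Π[ pairs< r ] (uncurry g) * Π[ pairs< r ] (uncurry g) ≡ Π[ allFin r ] (λ i → Π[ others i ] (g i))
    Π-pairs<-squared = begin
      Π[ pairs< r ] (uncurry g) * Π[ pairs< r ] (uncurry g)
        ≡⟨ cong₂ _*_ (Π-pairs< (uncurry g)) (trans (Π-pairs< (uncurry g)) Π-above≡Π-below) ⟩
      Π[ allFin r ] (λ i → Π[ above i ] (g i)) * Π[ allFin r ] (λ i → Π[ below i ] (g i))
        ≡⟨ Π-distrib-* (allFin r) (λ i → Π[ above i ] (g i)) (λ i → Π[ below i ] (g i)) ⟨
      Π[ allFin r ] (λ i → Π[ above i ] (g i) * Π[ below i ] (g i))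
        ≡⟨ Π-cong (allFin r) (λ i → Π-others i (g i)) ⟨
      Π[ allFin r ] (λ i → Π[ others i ] (g i))
        ∎
      where open ≡-Reasoning

    off-diagonal-bound : ∀ {n} → (∀ i j → toℕ i < toℕ j → g i j ≤ n) → ∀ i j → i ≢ j → g i j ≤ n
    off-diagonal-bound bound i j i≢j with <-cmp (toℕ i) (toℕ j)
    ... | tri< i<j _ _ = bound i j i<j
    ... | tri≈ _ i≡j _ = contradiction (toℕ-injective i≡j) i≢j
    ... | tri> _ _ j<i = subst (_≤ _) (g-sym j i) (bound j i j<i)

module _ {ℓ r : ℕ} (x : Array ℓ r) where

  entry-sym : ∀ m i j → entry x m i j ≡ entry x m j i
  entry-sym m i j = swap (toℕ i <? toℕ j) (toℕ j <? toℕ i)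
    where
    swap : (i<?j : Dec (toℕ i < toℕ j)) (j<?i : Dec (toℕ j < toℕ i)) →
           (if does i<?j then x m i j else x m j i) ≡ (if does j<?i then x m j i else x m i j)
    swap (yes i<j) (yes j<i) = contradiction j<i (<-asym i<j)
    swap (yes _)   (no _)    = refl
    swap (no _)    (yes _)   = refl
    swap (no i≮j)  (no j≮i)  = cong₂ (x m) (sym i≡j) i≡j
      where i≡j = toℕ-injective (≤-antisym (≮⇒≥ j≮i) (≮⇒≥ i≮j))

  ∣∣ᵢⱼ-sym : ∀ i j → ∣ x ∣ᵢⱼ i j ≡ ∣ x ∣ᵢⱼ j i
  ∣∣ᵢⱼ-sym i j = foldr-cong (λ m s → cong (_+ s) (entry-sym m i j)) refl (allFin ℓ)

lemma4p6 : (r ℓ n : ℕ) → 2 ≤ r → 1 ≤ ℓ → 1 ≤ n → (x : Array ℓ r)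
    → (∀ (i j : Fin r) → toℕ i < toℕ j → ∣ x ∣ᵢⱼ i j ≤ n)
    → (Π[ pairs< r ] (λ { (i , j) → n ⁽ ∣ x ∣ᵢⱼ i j ⁾ })) * (n ^ ∣ x ∣)
      ≤ (2 ^ (2 * ∣ x ∣)) * (Π[ allFin r ] (λ i → ((r ∸ 1) * n) ⁽ ∣ x ∣ᵢ i ⁾))
lemma4p6 r ℓ n _ _ _ x bound = begin
    P * n ^ ∣ x ∣                                                 ≤⟨ *-monoʳ-≤ P n^∣x∣≤4^∣x∣*P ⟩
    P * (4 ^ ∣ x ∣ * P)                                           ≡⟨ x∙yz≈y∙xz P (4 ^ ∣ x ∣) P ⟩
    4 ^ ∣ x ∣ * (P * P)                                           ≡⟨ cong₂ _*_ (^-*-assoc 2 2 ∣ x ∣) (Π-pairs<-squared g g-sym) ⟩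
    2 ^ (2 * ∣ x ∣) * Π[ allFin r ] (λ i → Π[ others i ] (g i))   ≤⟨ *-monoʳ-≤ (2 ^ (2 * ∣ x ∣)) (Π-mono-≤ (allFin r) row-bound) ⟩
    2 ^ (2 * ∣ x ∣) * Π[ allFin r ] (λ i → ((r ∸ 1) * n) ⁽ ∣ x ∣ᵢ i ⁾) ∎
  where
  open ≤-Reasoning
  g : Fin r → Fin r → ℕ
  g i j = n ⁽ ∣ x ∣ᵢⱼ i j ⁾
  g-sym : ∀ i j → g i j ≡ g j i
  g-sym i j = cong (n ⁽_⁾) (∣∣ᵢⱼ-sym x i j)
  P = Π[ pairs< r ] (uncurry g)
  n^∣x∣≤4^∣x∣*P : n ^ ∣ x ∣ ≤ 4 ^ ∣ x ∣ * P
  n^∣x∣≤4^∣x∣*P = n^Σ≤4^Σ*Πn⁽⁾ (pairs< r) (All.map (λ {(i , j)} → bound i j) pairs<-increasing)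
  row-bound : ∀ i → Π[ others i ] (g i) ≤ ((r ∸ 1) * n) ⁽ ∣ x ∣ᵢ i ⁾
  row-bound i = ≤-trans
    (Πn⁽⁾≤[length*n]⁽Σ⁾ (others i) (All.map (λ {j} → off-diagonal-bound (∣ x ∣ᵢⱼ) (∣∣ᵢⱼ-sym x) bound i j)
                                            (all-filter (λ j → ¬? (i ≟ j)) (allFin r))))
    (⁽⁾-monoˡ-≤ (∣ x ∣ᵢ i) (*-monoˡ-≤ n (length-others i)))
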